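{- For all integers $d\ge 4$ and $\ell\ge 4$, the diameter of the cyclic Kautz digraph $CK(d,\ell)$ is at most $2\ell-2$.
   Context: $CK(d,\ell)$ has as vertices all words $a_1\ldots a_\ell$ over an alphabet of $d+1$ symbols with $a_i\ne a_{i+1}$ for $1\le i\le\ell-1$ and $a_1\ne a_\ell$, and an arc from $a_1a_2\ldots a_\ell$ to $a_2\ldots a_\ell a_{\ell+1}$ whenever both words are vertices. The diameter is the maximum over ordered pairs of vertices of the directed distance. -}

module Defs where

open import Data.Nat using (ℕ; zero; suc; _+_; _∸_; _≤_; _<_)
open import Data.Fin using (Fin; fromℕ<)
open import Data.Vec using (Vec; lookup; _∷_; []; _∷ʳ_)
open import Data.Vec using (tail) public
open import Data.Product using (Σ; ∃; _×_; _,_)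
open import Relation.Binary.PropositionalEquality using (_≡_; _≢_)

Word : ℕ → ℕ → Set
Word d ℓ = Vec (Fin (suc d)) ℓ

-- Vertex condition of CK(d,ℓ): consecutive letters differ
-- (a_i ≠ a_{i+1}, 1 ≤ i ≤ ℓ-1) and a_1 ≠ a_ℓ  (0-indexed below).
IsVertex : ∀ {d ℓ} → Word d ℓ → Set
IsVertex {d} {ℓ} w =
  (∀ (i : ℕ) (p : suc i < ℓ) →
     lookup w (fromℕ< {i} (Data.Nat.Properties.<-trans (Data.Nat.Properties.n<1+n i) p))
       ≢ lookup w (fromℕ< p))
  × (∀ (m : ℕ) (p : 0 < ℓ) (q : m < ℓ) → suc m ≡ ℓ → lookup w (fromℕ< p) ≢ lookup w (fromℕ< q))
  where import Data.Nat.Properties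

Vertex : ℕ → ℕ → Set
Vertex d ℓ = Σ (Word d ℓ) IsVertex

Arc : ∀ {d ℓ} → Vertex d (suc ℓ) → Vertex d (suc ℓ) → Set
Arc {d} {ℓ} (u , _) (v , _) = ∃ λ (c : Fin (suc d)) → v ≡ tail u ∷ʳ c

data Walk {d ℓ : ℕ} : ℕ → Vertex d (suc ℓ) → Vertex d (suc ℓ) → Set where
  here : ∀ {u} → Walk 0 u u
  step : ∀ {k u v w} → Arc u v → Walk k v w → Walk (suc k) u w

DistLe : ∀ {d ℓ} → Vertex d (suc ℓ) → Vertex d (suc ℓ) → ℕ → Set
DistLe u v k = ∃ λ m → m ≤ k × Walk m u v

-- Diameter of CK(d, ℓ+1) is at most k: every ordered pair at distance ≤ k.
DiameterLe : ℕ → ℕ → ℕ → Set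
DiameterLe d ℓ k = ∀ (u v : Vertex d (suc ℓ)) → DistLe u v k

-- Write n = ℓ - 1. A walk of length k from u to v is a sequence of n + 1 + k
-- letters whose windows of length n + 1 are all vertices, the first being u and
-- the last v. Take u c₀ … c_{g-1} v with g + h = n, where h is chosen so that the
-- h window conditions comparing a letter of u with a letter of v already hold:
-- h = 1 if the last letter of u differs from the first letter of v, and h = 2
-- otherwise (then the Kautz conditions inside u and v do the job). Every other
-- condition involves a bridge letter cⱼ, which has to avoid only four letters
-- (its predecessor, the letter of u n places before it, and two letters
-- of v), so d + 1 ≥ 5 letters suffice. The walk has length n + 1 + g ≤ 2n.
module Submission where

open import Defs
open import Data.Nat using (ℕ; zero; suc; _+_; _*_; _∸_; _≤_; _<_; z≤n; s≤s; z<s; s<s)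
open import Data.Nat.Properties
  using (+-suc; +-assoc; +-comm; +-identityʳ; +-cancelˡ-<; +-cancelˡ-≤; +-monoʳ-≤;
         ≤-refl; ≤-trans; ≤-pred; <-trans; n<1+n; n≤1+n; m≤n+m; m+1+n≰m; module ≤-Reasoning)
open import Data.Fin using (Fin; fromℕ<)
open import Data.Fin.Properties using (pigeonhole; any?; ¬∀⟶∃¬; _≟_)
import Data.Fin.Properties as Fin
open import Data.Vec using (Vec; lookup; _∷_; []; _∷ʳ_)
open import Data.Product using (∃; _×_; _,_; proj₁; proj₂)
open import Function using (_∘_)
open import Relation.Nullary using (¬_; yes; no)
open import Relation.Binary.PropositionalEquality

≢-resp : ∀ {X : Set} {x x′ y y′ : X} → x ≡ x′ → y ≡ y′ → x′ ≢ y′ → x ≢ y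
≢-resp refl refl x′≢y′ = x′≢y′

∃-∉-image : ∀ {m n} → m < n → (f : Fin m → Fin n) → ∃ λ c → ∀ i → c ≢ f i
∃-∉-image {m} {n} m<n f with ¬∀⟶∃¬ n (λ c → ∃ λ i → c ≡ f i) (λ c → any? (λ i → c ≟ f i)) ¬onto
  where
  ¬onto : ¬ (∀ c → ∃ λ i → c ≡ f i)
  ¬onto hit with pigeonhole m<n (proj₁ ∘ hit)
  ... | i , j , i<j , same =
    Fin.<-irrefl (trans (proj₂ (hit i)) (trans (cong f same) (sym (proj₂ (hit j))))) i<j
... | c , c∉ = c , λ i c≡fi → c∉ (i , c≡fi)

fresh : ∀ {d} → 4 ≤ d → (x₀ x₁ x₂ x₃ : Fin (suc d)) →
        ∃ λ c → c ≢ x₀ × c ≢ x₁ × c ≢ x₂ × c ≢ x₃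
fresh hd x₀ x₁ x₂ x₃ with ∃-∉-image (s≤s hd) (lookup (x₀ ∷ x₁ ∷ x₂ ∷ x₃ ∷ []))
... | c , c∉ = c , c∉ Fin.zero , c∉ (Fin.suc Fin.zero) ,
               c∉ (Fin.suc (Fin.suc Fin.zero)) , c∉ (Fin.suc (Fin.suc (Fin.suc Fin.zero)))

data Split (g : ℕ) : ℕ → Set where
  below : ∀ {i} → i < g → Split g i
  above : ∀ k → Split g (g + k)

split : ∀ g i → Split g i
split zero    i       = above i
split (suc g) zero    = below z<s
split (suc g) (suc i) with split g i
... | below i<g = below (s<s i<g)
... | above k   = above k

module _ {X : Set} where

  window : (ℕ → X) → (n : ℕ) → Vec X n
  window s zero    = []
  window s (suc n) = s 0 ∷ window (s ∘ suc) n

  lookup-window : ∀ s {n} i (p : i < n) → lookup (window s n) (fromℕ< p) ≡ s i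
  lookup-window s zero    (s≤s p) = refl
  lookup-window s (suc i) (s≤s p) = lookup-window (s ∘ suc) i p

  window-∷ʳ : ∀ s n → window s (suc n) ≡ window s n ∷ʳ s n
  window-∷ʳ s zero    = refl
  window-∷ʳ s (suc n) = cong (s 0 ∷_) (window-∷ʳ (s ∘ suc) n)

  window-cong : ∀ {f f′} n → (∀ i → i < n → f i ≡ f′ i) → window f n ≡ window f′ n
  window-cong zero    f≡f′ = refl
  window-cong (suc n) f≡f′ =
    cong₂ _∷_ (f≡f′ 0 z<s) (window-cong n (λ i i<n → f≡f′ (suc i) (s<s i<n)))

  letters : ∀ {n} → X → Vec X n → ℕ → X
  letters x []      i       = x
  letters x (y ∷ w) zero    = y
  letters x (y ∷ w) (suc i) = letters x w i

  letters-lookup : ∀ x {n} (w : Vec X n) i (p : i < n) → letters x w i ≡ lookup w (fromℕ< p)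
  letters-lookup x (y ∷ w) zero    p       = refl
  letters-lookup x (y ∷ w) (suc i) (s≤s p) = letters-lookup x w i p

  window-letters : ∀ x {n} (w : Vec X n) → window (letters x w) n ≡ w
  window-letters x []      = refl
  window-letters x (y ∷ w) = cong (y ∷_) (window-letters x w)

  prepend : ℕ → (ℕ → X) → (ℕ → X) → ℕ → X
  prepend zero    f h i       = h i
  prepend (suc g) f h zero    = f 0
  prepend (suc g) f h (suc i) = prepend g (f ∘ suc) h i

  prepend-< : ∀ g f h i → i < g → prepend g f h i ≡ f i
  prepend-< (suc g) f h zero    _       = refl
  prepend-< (suc g) f h (suc i) (s≤s p) = prepend-< g (f ∘ suc) h i p

  prepend-+ : ∀ g f h k → prepend g f h (g + k) ≡ h k
  prepend-+ zero    f h k = refl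
  prepend-+ (suc g) f h k = prepend-+ g (f ∘ suc) h k

  KautzPrefix : ℕ → (ℕ → X) → Set
  KautzPrefix n s = ∀ i → i < n → s i ≢ s (suc i)

  CyclicKautzPrefix : ℕ → (ℕ → X) → Set
  CyclicKautzPrefix n s = KautzPrefix n s × s 0 ≢ s n

  prepend-kautz : ∀ {n M f h} → KautzPrefix n f → f n ≢ h 0 → KautzPrefix M h →
                  KautzPrefix (suc n + M) (prepend (suc n) f h)
  prepend-kautz {zero}  f-ok join h-ok zero    _         = join
  prepend-kautz {zero}  f-ok join h-ok (suc i) (s<s i<M) = h-ok i i<M
  prepend-kautz {suc n} f-ok join h-ok zero    _         = f-ok 0 z<s
  prepend-kautz {suc n} f-ok join h-ok (suc i) (s<s i<)  =
    prepend-kautz {n} (λ j j<n → f-ok (suc j) (s<s j<n)) join h-ok i i<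

module _ {d n : ℕ} where

  window-isVertex : ∀ s → CyclicKautzPrefix n s → IsVertex {d} (window s (suc n))
  window-isVertex s (kautz , ends) =
    (λ i p → ≢-resp (lookup-window s i (<-trans (n<1+n i) p)) (lookup-window s (suc i) p)
                    (kautz i (≤-pred p))) ,
    λ { m p q refl → ≢-resp (lookup-window s 0 p) (lookup-window s m q) ends }

  vertex-letters : ∀ (u : Vertex d (suc n)) → CyclicKautzPrefix n (letters Fin.zero (proj₁ u))
  vertex-letters (w , adjacent , cyclic) = kautz , ends
    where
    kautz : KautzPrefix n (letters Fin.zero w)
    kautz i i<n = ≢-resp (letters-lookup Fin.zero w i (<-trans (n<1+n i) (s<s i<n)))
                         (letters-lookup Fin.zero w (suc i) (s<s i<n))
                         (adjacent i (s<s i<n))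
    ends : letters Fin.zero w 0 ≢ letters Fin.zero w n
    ends = ≢-resp (letters-lookup Fin.zero w 0 z<s) (letters-lookup Fin.zero w n ≤-refl)
                  (cyclic n z<s ≤-refl refl)

  arc-window : ∀ s (u v : Vertex d (suc n)) →
               proj₁ u ≡ window s (suc n) → proj₁ v ≡ window (s ∘ suc) (suc n) → Arc u v
  arc-window s u v refl v≡ = s (suc n) , trans v≡ (window-∷ʳ (s ∘ suc) n)

  walk-along : ∀ s T (u v : Vertex d (suc n)) →
               proj₁ u ≡ window s (suc n) → proj₁ v ≡ window (λ i → s (suc T + i)) (suc n) →
               KautzPrefix (suc T + n) s → (∀ t → t ≤ suc T → s t ≢ s (t + n)) →
               Walk (suc T) u v
  walk-along s zero    u v u≡ v≡ kautz gap = step (arc-window s u v u≡ v≡) here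
  walk-along s (suc T) u v u≡ v≡ kautz gap =
    step (arc-window s u w u≡ refl)
         (walk-along (s ∘ suc) T w v refl v≡ (λ i p → kautz (suc i) (s<s p))
                     (λ t p → gap (suc t) (s≤s p)))
    where
    w : Vertex d (suc n)
    w = window (s ∘ suc) (suc n) ,
        window-isVertex (s ∘ suc) ((λ i p → kautz (suc i) (s<s (≤-trans p (m≤n+m n (suc T)))))
                                  , gap 1 (s≤s z≤n))

module Bridge {d n : ℕ} (hd : 4 ≤ d) (g′ h : ℕ) (g+h≡n : suc g′ + h ≡ n)
              (u v : Vertex d (suc n)) where

  g : ℕ
  g = suc g′

  A B : ℕ → Fin (suc d)
  A = letters Fin.zero (proj₁ u)
  B = letters Fin.zero (proj₁ v)

  previous : ℕ → Fin (suc d)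
  bridge   : ℕ → Fin (suc d)
  previous zero    = A n
  previous (suc j) = bridge j
  bridge j = proj₁ (fresh hd (previous j) (A (suc j)) (B (j + h)) (B 0))

  bridge-fresh : ∀ j → bridge j ≢ previous j × bridge j ≢ A (suc j) ×
                       bridge j ≢ B (j + h) × bridge j ≢ B 0
  bridge-fresh j = proj₂ (fresh hd (previous j) (A (suc j)) (B (j + h)) (B 0))

  H s : ℕ → Fin (suc d)
  H = prepend g bridge B
  s = prepend (suc n) A H

  s-kautz : KautzPrefix (suc n + g + n) s
  s-kautz = subst (λ m → KautzPrefix m s) (sym (+-assoc (suc n) g n))
    (prepend-kautz (proj₁ (vertex-letters u)) (≢-sym (proj₁ (bridge-fresh 0)))
      (prepend-kautz (λ i _ → ≢-sym (proj₁ (bridge-fresh (suc i))))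
                     (proj₂ (proj₂ (proj₂ (bridge-fresh g′))))
                     (proj₁ (vertex-letters v))))

  -- the h window conditions comparing a letter of u with one of v
  module _ (crossing : ∀ k → k < h → A (suc (k + g)) ≢ B k) where

    A-gap : ∀ i → i < n → A (suc i) ≢ H i
    A-gap i i<n with split g i
    ... | below i<g = ≢-resp refl (prepend-< g bridge B i i<g)
                             (≢-sym (proj₁ (proj₂ (bridge-fresh i))))
    ... | above k   = ≢-resp (cong (A ∘ suc) (+-comm g k)) (prepend-+ g bridge B k)
                             (crossing k (+-cancelˡ-< g k h (subst (g + k <_) (sym g+h≡n) i<n)))

    H-gap : ∀ j → j ≤ g → H j ≢ H (j + n)
    H-gap j j≤g with split g j
    ... | below j<g = ≢-resp (prepend-< g bridge B j j<g)
                             (trans (cong H j+n≡g+[j+h]) (prepend-+ g bridge B (j + h)))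
                             (proj₁ (proj₂ (proj₂ (bridge-fresh j))))
      where
      j+n≡g+[j+h] : j + n ≡ g + (j + h)
      j+n≡g+[j+h] = begin
        j + n       ≡⟨ cong (j +_) (sym g+h≡n) ⟩
        j + (g + h) ≡⟨ sym (+-assoc j g h) ⟩
        j + g + h   ≡⟨ cong (_+ h) (+-comm j g) ⟩
        g + j + h   ≡⟨ +-assoc g j h ⟩
        g + (j + h) ∎
        where open ≡-Reasoning
    ... | above zero    = ≢-resp (prepend-+ g bridge B 0)
                                 (trans (cong H (+-assoc g 0 n)) (prepend-+ g bridge B n))
                                 (proj₂ (vertex-letters v))
    ... | above (suc k) = λ _ → m+1+n≰m g j≤g

    s-gap : ∀ t → t ≤ suc n + g → s t ≢ s (t + n)
    s-gap t t≤ with split (suc n) t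
    s-gap zero    _ | below _ =
      ≢-resp refl (prepend-< (suc n) A H n ≤-refl) (proj₂ (vertex-letters u))
    s-gap (suc i) _ | below (s<s i<n) =
      ≢-resp (prepend-< (suc n) A H (suc i) (s<s i<n))
             (trans (cong (s ∘ suc) (+-comm i n)) (prepend-+ (suc n) A H i))
             (A-gap i i<n)
    s-gap _ t≤ | above j =
      ≢-resp (prepend-+ (suc n) A H j)
             (trans (cong s (+-assoc (suc n) j n)) (prepend-+ (suc n) A H (j + n)))
             (H-gap j (+-cancelˡ-≤ (suc n) j g t≤))

    walk : Walk (suc n + g) u v
    walk = walk-along s (n + g) u v u≡ v≡ s-kautz s-gap
      where
      u≡ : proj₁ u ≡ window s (suc n)
      u≡ = sym (trans (window-cong (suc n) (prepend-< (suc n) A H))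
                      (window-letters Fin.zero (proj₁ u)))
      v≡ : proj₁ v ≡ window (λ i → s (suc n + g + i)) (suc n)
      v≡ = sym (trans (window-cong (suc n) λ i _ →
                         trans (cong s (+-assoc (suc n) g i))
                               (trans (prepend-+ (suc n) A H (g + i)) (prepend-+ g bridge B i)))
                      (window-letters Fin.zero (proj₁ v)))

walk-length-bound : ∀ {n g} → g < n → suc n + g ≤ 2 * suc n ∸ 2
walk-length-bound {n} {g} g<n = begin
  suc n + g         ≡⟨ sym (+-suc n g) ⟩
  n + suc g         ≤⟨ +-monoʳ-≤ n g<n ⟩
  n + n             ≡⟨ cong (n +_) (sym (+-identityʳ n)) ⟩
  n + (n + 0)       ≡⟨ cong (_∸ 1) (sym (+-suc n (n + 0))) ⟩
  2 * suc n ∸ 2     ∎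
  where open ≤-Reasoning

lemma10 : ∀ (d ℓ : ℕ) → 4 ≤ d → 4 ≤ ℓ →
    DiameterLe d (ℓ ∸ 1) (2 * ℓ ∸ 2)
lemma10 d (suc (suc (suc (suc k)))) hd (s≤s (s≤s (s≤s (s≤s z≤n)))) u v
  with letters Fin.zero (proj₁ u) (3 + k) ≟ letters Fin.zero (proj₁ v) 0
... | no  last≢first = _ , walk-length-bound {g = 2 + k} ≤-refl ,
  Bridge.walk hd (suc k) 1 (cong (2 +_) (+-comm k 1)) u v λ
    { zero    _         → last≢first
    ; (suc _) (s<s ()) }
... | yes last≡first = _ , walk-length-bound {g = 1 + k} (n≤1+n _) ,
  Bridge.walk hd k 2 (cong suc (+-comm k 2)) u v λ
    { zero       _ → ≢-resp refl (sym last≡first) (u-kautz (2 + k) ≤-refl)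
    ; (suc zero) _ → ≢-resp last≡first refl (v-kautz 0 z<s)
    ; (suc (suc _)) (s<s (s<s ())) }
  where
  u-kautz : KautzPrefix (3 + k) (letters Fin.zero (proj₁ u))
  u-kautz = proj₁ (vertex-letters u)
  v-kautz : KautzPrefix (3 + k) (letters Fin.zero (proj₁ v))
  v-kautz = proj₁ (vertex-letters v)
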